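{- Let $k\ge 3$, $t=2k-1$, $r=\binom{k}{2}-1$. Let $n \equiv 1 \pmod{t(t-1)}$ and let $D$ be a family of $t$-subsets of $[n]$ such that every pair of elements of $[n]$ lies in exactly one member of $D$. Let $G$ be a graph with vertex set $[n]$ and let $\pi$ be a permutation of $[n]$. If $\pi$ is good, then $G$ has an $\mathcal{F}_k$-decomposition, where $\mathcal{F}_k=\{K_k,K_{2k-1},K_{2k-1}^-\}$.
   Context: All graphs are finite, undirected and simple. $K_t$ is the complete graph on $t$ vertices and $K_t^-$ is $K_t$ minus one edge. For a family $\mathcal{F}$ of graphs, an $\mathcal{F}$-decomposition of $G$ is a set of subgraphs of $G$, each isomorphic to an element of $\mathcal{F}$, such that each edge of $G$ lies in exactly one of them. For $S\in D$ let $S_\pi=\{\pi(j):j\in S\}$, and let $G_\pi$ be the family of edge-disjoint subgraphs $G[S_\pi]$, $S\in D$. Let $F_\pi\subseteq G_\pi$ be the set of elements of $G_\pi$ isomorphic to $K_t$, and let $A_\pi$ be the set of edges of $G$ lying in elements of $G_\pi$ not isomorphic to $K_t$. An $r$-subset $\{H_1,\dots,H_r\}$ of $F_\pi$ is good for $e\in A_\pi$ if one can select edges $f_i\in E(H_i)$ such that $\{f_1,\dots,f_r,e\}$ is the edge set of a copy of $K_k$ in $G$. The permutation $\pi$ is good if for each $e\in A_\pi$ there is an $r$-subset $S(e)$ of $F_\pi$ that is good for $e$, such that $S(e)\cap S(e')=\emptyset$ whenever $e\neq e'$. -}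

module Defs where

open import Data.Nat using (ℕ; zero; suc; _+_; _*_; _∸_; _≤_)
open import Data.Nat.Combinatorics using (_C_)
open import Data.Fin using (Fin; toℕ; _<_)
open import Data.Fin.Subset using (Subset; _∈_; ∣_∣)
open import Data.Fin.Permutation using (Permutation′; _⟨$⟩ˡ_)
open import Data.Bool using (Bool; true; false; not; _∧_)
open import Data.Product using (Σ; ∃; ∃-syntax; _×_; _,_; proj₁; proj₂)
open import Data.Sum using (_⊎_)
open import Relation.Nullary using (¬_; does)
open import Relation.Binary.PropositionalEquality using (_≡_; _≢_)
open import Function.Definitions using (Injective)
import Data.Fin as F
import Data.Nat as N

record Graph (n : ℕ) : Set where
  field
    adj     : Fin n → Fin n → Bool
    adj-sym : ∀ u v → adj u v ≡ adj v u
    adj-irr : ∀ u → adj u u ≡ false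
open Graph public

K : (m : ℕ) → Graph m
K m = record { adj = λ i j → not (does (i F.≟ j))
             ; adj-sym = sym'
             ; adj-irr = irr }
  where
    open import Relation.Binary.PropositionalEquality using (refl; sym; cong)
    open import Relation.Nullary using (yes; no)
    sym' : ∀ i j → not (does (i F.≟ j)) ≡ not (does (j F.≟ i))
    sym' i j with i F.≟ j | j F.≟ i
    ... | yes _ | yes _ = refl
    ... | no _  | no _  = refl
    ... | yes p | no q  = Data.Empty.⊥-elim (q (sym p)) where import Data.Empty
    ... | no p  | yes q = Data.Empty.⊥-elim (p (sym q)) where import Data.Empty
    irr : ∀ i → not (does (i F.≟ i)) ≡ false
    irr i with i F.≟ i
    ... | yes _ = refl
    ... | no p  = Data.Empty.⊥-elim (p refl) where import Data.Empty

-- K⁻ m : complete graph on Fin m minus the edge {0,1}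
-- (the pair {i,j} is {0,1} iff toℕ i + toℕ j ≡ 1)
K⁻ : (m : ℕ) → Graph m
K⁻ m = record { adj = λ i j → Graph.adj (K m) i j ∧ not (does ((toℕ i + toℕ j) N.≟ 1))
              ; adj-sym = sym'
              ; adj-irr = irr }
  where
    open import Relation.Binary.PropositionalEquality using (refl; cong₂; cong)
    open import Data.Nat.Properties using (+-comm)
    sym' : ∀ i j → (Graph.adj (K m) i j ∧ not (does ((toℕ i + toℕ j) N.≟ 1)))
                 ≡ (Graph.adj (K m) j i ∧ not (does ((toℕ j + toℕ i) N.≟ 1)))
    sym' i j = cong₂ _∧_ (Graph.adj-sym (K m) i j)
                 (cong (λ x → not (does (x N.≟ 1))) (+-comm (toℕ i) (toℕ j)))
    irr : ∀ i → (Graph.adj (K m) i i ∧ not (does ((toℕ i + toℕ i) N.≟ 1))) ≡ false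
    irr i rewrite Graph.adj-irr (K m) i = refl

-- Subgraphs of G isomorphic to a pattern graph H on Fin m:
-- exactly the images of injective adjacency-preserving maps Fin m → Fin n.

record Copy {n m : ℕ} (G : Graph n) (H : Graph m) : Set where
  field
    φ     : Fin m → Fin n
    φ-inj : Injective _≡_ _≡_ φ
    φ-hom : ∀ i j → adj H i j ≡ true → adj G (φ i) (φ j) ≡ true
open Copy public

EdgeIn : {n m : ℕ} {G : Graph n} {H : Graph m} → Copy G H → Fin n → Fin n → Set
EdgeIn {H = H} c u v = ∃[ i ] ∃[ j ] (adj H i j ≡ true × φ c i ≡ u × φ c j ≡ v)

data Shape : Set where
  shK shT shT⁻ : Shape

tOf : ℕ → ℕ
tOf k = 2 * k ∸ 1

rOf : ℕ → ℕ
rOf k = (k C 2) ∸ 1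

shapeSize : ℕ → Shape → ℕ
shapeSize k shK  = k
shapeSize k shT  = tOf k
shapeSize k shT⁻ = tOf k

shapeGraph : (k : ℕ) → (s : Shape) → Graph (shapeSize k s)
shapeGraph k shK  = K k
shapeGraph k shT  = K (tOf k)
shapeGraph k shT⁻ = K⁻ (tOf k)

record FkDecomposition (k : ℕ) {n : ℕ} (G : Graph n) : Set where
  field
    N      : ℕ
    shape  : Fin N → Shape
    piece  : (c : Fin N) → Copy G (shapeGraph k (shape c))
    cover  : ∀ u v → adj G u v ≡ true → ∃[ c ] EdgeIn (piece c) u v
    unique : ∀ u v → adj G u v ≡ true → ∀ c c' →
             EdgeIn (piece c) u v → EdgeIn (piece c') u v → c ≡ c'

record PairDesign (n t : ℕ) : Set where
  field
    b       : ℕ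
    blk     : Fin b → Subset n
    blk-size : ∀ B → ∣ blk B ∣ ≡ t
    pair-cover  : ∀ i j → i ≢ j → ∃[ B ] (i ∈ blk B × j ∈ blk B)
    pair-unique : ∀ i j → i ≢ j → ∀ B B' →
                  i ∈ blk B → j ∈ blk B → i ∈ blk B' → j ∈ blk B' → B ≡ B'
open PairDesign public

module _ {n t : ℕ} (D : PairDesign n t) (G : Graph n) (π : Permutation′ n) where

  -- x ∈ S_π  iff  π⁻¹(x) ∈ S
  _∈π_ : Fin n → Fin (b D) → Set
  x ∈π B = (π ⟨$⟩ˡ x) ∈ blk D B

  -- G[S_π] is isomorphic to K_t (|S_π| = t), i.e. G[S_π] is complete
  IsKt : Fin (b D) → Set
  IsKt B = ∀ x y → x ∈π B → y ∈π B → x ≢ y → adj G x y ≡ true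

  InA : Fin n → Fin n → Set
  InA u v = adj G u v ≡ true × ∃[ B ] (u ∈π B × v ∈π B × ¬ IsKt B)

  EdgeOfBlock : Fin (b D) → Fin n → Fin n → Set
  EdgeOfBlock B x y = x ∈π B × y ∈π B × adj G x y ≡ true

  record RSubset (r : ℕ) : Set where
    field
      sel     : Fin r → Fin (b D)
      sel-inj : Injective _≡_ _≡_ sel
      sel-Kt  : ∀ l → IsKt (sel l)
  open RSubset public

  SameEdge : Fin n → Fin n → Fin n → Fin n → Set
  SameEdge a c x y = (a ≡ x × c ≡ y) ⊎ (a ≡ y × c ≡ x)

  IsEdgeSetOf : {k r : ℕ} → Copy G (K k) → (Fin r → Fin n × Fin n) → Fin n → Fin n → Set
  IsEdgeSetOf {k} {r} κ f u v =
      EdgeIn κ u v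
    × (∀ l → EdgeIn κ (proj₁ (f l)) (proj₂ (f l)))
    × (∀ i j → adj (K k) i j ≡ true →
         SameEdge (φ κ i) (φ κ j) u v
         ⊎ ∃[ l ] SameEdge (φ κ i) (φ κ j) (proj₁ (f l)) (proj₂ (f l)))

  GoodFor : (k : ℕ) → RSubset (rOf k) → Fin n → Fin n → Set
  GoodFor k S u v =
    Σ (Fin (rOf k) → Fin n × Fin n) λ f →
           ((∀ l → EdgeOfBlock (sel S l) (proj₁ (f l)) (proj₂ (f l)))
            × ∃[ κ ] IsEdgeSetOf {k} {rOf k} κ f u v)

  -- π is good.  Edges e ∈ A_π are represented as pairs u < v.
  record GoodPerm (k : ℕ) : Set where
    field
      S       : ∀ u v → u < v → InA u v → RSubset (rOf k)
      S-good  : ∀ u v (p : u < v) (a : InA u v) → GoodFor k (S u v p a) u v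
      S-disj  : ∀ u v u' v' (p : u < v) (p' : u' < v') (a : InA u v) (a' : InA u' v') →
                ¬ (u ≡ u' × v ≡ v') →
                ∀ l l' → sel (S u v p a) l ≢ sel (S u' v' p' a') l'

-- The pieces are: for every edge e of A_π, the copy of K_k witnessing that S(e) is good for e;
-- for every complete block G[S_π] that lies in no S(e), the block itself, a copy of K_t; and for
-- a complete block that does lie in some S(e) (by disjointness, in exactly one, through the edge f
-- that this S(e) contributes to its K_k), the block minus f, a copy of K_t^-. Since the blocks
-- partition the edges of G, an edge of a non-complete block lies in A_π and only in its own K_k,
-- while an edge of a complete block lies in that block's piece unless it is the removed edge f,
-- which lies only in the K_k that used it.

module Submission where

open import Defs
open import Data.Nat as ℕ using (ℕ; zero; suc; 2+; _+_; _*_; _∸_; _≤_)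
open import Data.Bool using (true)
open import Data.Bool.Properties using (∧-zeroʳ) renaming (_≟_ to _≟ᵇ_)
open import Data.Empty using (⊥; ⊥-elim)
open import Data.Unit using (⊤; tt)
open import Data.Fin as Fin using (Fin; zero; suc; toℕ; punchOut)
open import Data.Fin.Patterns using (0F; 1F)
open import Data.Fin.Properties using (_≟_; suc-injective; punchIn-punchOut; all?; any?; _<?_; <-cmp; <-asym; +↔⊎; *↔×)
open import Data.Fin.Subset using (Subset; inside; outside; _∈_; ∣_∣)
open import Data.Fin.Subset.Properties using (drop-there; _∈?_)
open import Data.Fin.Permutation using (Permutation′; _⟨$⟩ʳ_; _⟨$⟩ˡ_; insert; id; flip)
open import Data.Product using (Σ; Σ-syntax; ∃-syntax; _×_; _,_; proj₁; proj₂)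
open import Data.Sum using (_⊎_; inj₁; inj₂)
open import Data.Vec using ([]; _∷_; here; there)
open import Function using (_∘_; case_of_)
open import Function.Bundles using (_↔_; _⇔_; Inverse; Injection; Equivalence; mk⇔)
open import Function.Definitions using (Injective)
open import Function.Properties.Inverse using (↔⇒↣)
open import Relation.Binary.Definitions using (tri<; tri≈; tri>)
open import Relation.Binary.PropositionalEquality using (_≡_; _≢_; refl; sym; trans; cong; cong₂; subst; subst₂)
open import Relation.Nullary using (¬_; Dec; yes; no; contradiction)
open import Relation.Nullary.Decidable using (dec-true; dec-false; _×-dec_; _⊎-dec_; _→-dec_; ¬?)
open import Relation.Unary using (Decidable)

record Enumeration {A : Set} (P : A → Set) (N : ℕ) : Set where
  field
    element   : Fin N → A
    injective : Injective _≡_ _≡_ element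
    sound     : ∀ i → P (element i)
    complete  : ∀ x → P x → ∃[ i ] element i ≡ x
open Enumeration public

module _ {A : Set} {P : A → Set} {N : ℕ} where

  reindex : ∀ {M} → Fin M ↔ Fin N → Enumeration P N → Enumeration P M
  reindex σ E = record
    { element   = element E ∘ to
    ; injective = Injection.injective (↔⇒↣ σ) ∘ injective E
    ; sound     = sound E ∘ to
    ; complete  = λ x px → let i , eq = complete E x px
                           in from i , trans (cong (element E) (strictlyInverseˡ i)) eq
    }
    where open Inverse σ

  map-↔ : ∀ {B : Set} (ι : A ↔ B) → Enumeration P N → Enumeration (P ∘ Inverse.from ι) N
  map-↔ ι E = record
    { element   = to ∘ element E
    ; injective = injective E ∘ Injection.injective (↔⇒↣ ι)
    ; sound     = λ i → subst P (sym (strictlyInverseʳ (element E i))) (sound E i)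
    ; complete  = λ y py → let i , eq = complete E (from y) py
                           in i , trans (cong to eq) (strictlyInverseˡ y)
    }
    where open Inverse ι

  transfer : ∀ {Q : A → Set} → (∀ {x} → P x → Q x) → (∀ {x} → Q x → P x) →
             Enumeration P N → Enumeration Q N
  transfer P⇒Q Q⇒P E = record
    { element   = element E
    ; injective = injective E
    ; sound     = P⇒Q ∘ sound E
    ; complete  = λ x → complete E x ∘ Q⇒P
    }

enumeration-Fin0 : {P : Fin 0 → Set} → Enumeration P 0
enumeration-Fin0 = record { element = λ () ; injective = λ {} ; sound = λ () ; complete = λ () }

module _ {m N : ℕ} {P : Fin (suc m) → Set} where

  skip-zero : ¬ P zero → Enumeration (P ∘ suc) N → Enumeration P N
  skip-zero ¬P0 E = record
    { element   = suc ∘ element E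
    ; injective = injective E ∘ suc-injective
    ; sound     = sound E
    ; complete  = λ { zero P0 → contradiction P0 ¬P0
                    ; (suc x) px → let i , eq = complete E x px in i , cong suc eq }
    }

  cons-zero : P zero → Enumeration (P ∘ suc) N → Enumeration P (suc N)
  cons-zero P0 E = record
    { element   = element′
    ; injective = injective′
    ; sound     = λ { zero → P0 ; (suc i) → sound E i }
    ; complete  = λ { zero _ → zero , refl
                    ; (suc x) px → let i , eq = complete E x px in suc i , cong suc eq }
    }
    where
    element′ : Fin (suc N) → Fin (suc m)
    element′ zero    = zero
    element′ (suc i) = suc (element E i)

    injective′ : Injective _≡_ _≡_ element′
    injective′ {zero}  {zero}  _  = refl
    injective′ {suc i} {suc j} eq = cong suc (injective E (suc-injective eq))

subsetEnumeration : ∀ {n} (p : Subset n) → Enumeration (_∈ p) ∣ p ∣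
subsetEnumeration []            = enumeration-Fin0
subsetEnumeration (outside ∷ p) = skip-zero (λ ()) (transfer there drop-there (subsetEnumeration p))
subsetEnumeration (inside ∷ p)  = cons-zero here (transfer there drop-there (subsetEnumeration p))

decidableEnumeration : ∀ {m} {P : Fin m → Set} → Decidable P → ∃[ N ] Enumeration P N
decidableEnumeration {zero}  P? = 0 , enumeration-Fin0
decidableEnumeration {suc m} P? with decidableEnumeration (P? ∘ suc) | P? zero
... | N , E | yes P0 = suc N , cons-zero P0 E
... | N , E | no ¬P0 = N , skip-zero ¬P0 E

decidableEnumeration-↔ : ∀ {A : Set} {P : A → Set} {m} → Fin m ↔ A → Decidable P → ∃[ N ] Enumeration P N
decidableEnumeration-↔ {P = P} ι P? =
  let N , E = decidableEnumeration (P? ∘ to)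
  in  N , transfer (subst P (strictlyInverseˡ _)) (subst P (sym (strictlyInverseˡ _))) (map-↔ ι E)
  where open Inverse ι

-- Defs' SameEdge, without the parameters D, G, π that it does not use.
SamePair : {A : Set} → A → A → A → A → Set
SamePair x y a c = (x ≡ a × y ≡ c) ⊎ (x ≡ c × y ≡ a)

SamePair? : ∀ {n} (x y a c : Fin n) → Dec (SamePair x y a c)
SamePair? x y a c = ((x ≟ a) ×-dec (y ≟ c)) ⊎-dec ((x ≟ c) ×-dec (y ≟ a))

SamePair-subst : ∀ {A : Set} {P : A → Set} {x y a c} → SamePair x y a c → P a → P c → P x × P y
SamePair-subst (inj₁ (refl , refl)) pa pc = pa , pc
SamePair-subst (inj₂ (refl , refl)) pa pc = pc , pa

pairToFront : ∀ {m} {a c : Fin (2+ m)} → a ≢ c →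
              Σ (Permutation′ (2+ m)) λ σ → σ ⟨$⟩ʳ 0F ≡ a × σ ⟨$⟩ʳ 1F ≡ c
pairToFront {a = a} a≢c = insert 0F a (insert 0F (punchOut a≢c) id) , refl , punchIn-punchOut a≢c

toℕ+toℕ≡1 : ∀ {m} {i j : Fin (2+ m)} → toℕ i + toℕ j ≡ 1 → SamePair i j 0F 1F
toℕ+toℕ≡1 {i = 0F} {1F} _ = inj₁ (refl , refl)
toℕ+toℕ≡1 {i = 1F} {0F} _ = inj₂ (refl , refl)

-- The only non-adjacent pair of positions of K⁻ t is {0, 1}, the pair with toℕ i + toℕ j ≡ 1.
StartsWith : ∀ {A : Set} {P : A → Set} {t} → Enumeration P t → A → A → Set
StartsWith E a c = ∀ {i j} → toℕ i + toℕ j ≡ 1 ⇔ SamePair (element E i) (element E j) a c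

enumerationStartingWith : ∀ {A : Set} {P : A → Set} {t a c} → Enumeration P t → P a → P c → a ≢ c →
                   Σ[ E ∈ Enumeration P t ] StartsWith E a c
enumerationStartingWith {t = 0} E pa _ _ = case complete E _ pa of λ ()
enumerationStartingWith {t = 1} E pa pc a≢c with complete E _ pa | complete E _ pc
... | 0F , ea | 0F , ec = ⊥-elim (a≢c (trans (sym ea) ec))
enumerationStartingWith {A = A} {t = 2+ m} E pa pc a≢c with complete E _ pa | complete E _ pc
... | ia , refl | ic , refl with pairToFront {a = ia} {ic} (a≢c ∘ cong (element E))
... | σ , σ0 , σ1 = reindex σ E , λ {i} {j} → mk⇔ (pair-of-ends {i} {j}) (ends-of-pair {i} {j})
  where
  e : Fin (2+ m) → A
  e i = element E (σ ⟨$⟩ʳ i)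

  e0 : e 0F ≡ element E ia
  e0 = cong (element E) σ0

  e1 : e 1F ≡ element E ic
  e1 = cong (element E) σ1

  position : ∀ {i j} → e i ≡ e j → i ≡ j
  position = Injection.injective (↔⇒↣ σ) ∘ injective E

  pair-of-ends : ∀ {i j} → toℕ i + toℕ j ≡ 1 → SamePair (e i) (e j) (element E ia) (element E ic)
  pair-of-ends {i} {j} s with toℕ+toℕ≡1 {i = i} {j} s
  ... | inj₁ (refl , refl) = inj₁ (e0 , e1)
  ... | inj₂ (refl , refl) = inj₂ (e1 , e0)

  ends-of-pair : ∀ {i j} → SamePair (e i) (e j) (element E ia) (element E ic) → toℕ i + toℕ j ≡ 1
  ends-of-pair {i} {j} (inj₁ (p , q))
    rewrite position {i} {0F} (trans p (sym e0)) | position {j} {1F} (trans q (sym e1)) = refl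
  ends-of-pair {i} {j} (inj₂ (p , q))
    rewrite position {i} {1F} (trans p (sym e1)) | position {j} {0F} (trans q (sym e0)) = refl

adj⇒≢ : ∀ {m} (H : Graph m) {i j} → adj H i j ≡ true → i ≢ j
adj⇒≢ H {i} h refl = case trans (sym h) (adj-irr H i) of λ ()

≢⇒adj-K : ∀ {m} {i j : Fin m} → i ≢ j → adj (K m) i j ≡ true
≢⇒adj-K {i = i} {j} i≢j rewrite dec-false (i ≟ j) i≢j = refl

adj-K⁻⇒ : ∀ {m} {i j : Fin m} → adj (K⁻ m) i j ≡ true → toℕ i + toℕ j ≢ 1
adj-K⁻⇒ {m} {i} {j} h s≡1
  rewrite dec-true (toℕ i + toℕ j ℕ.≟ 1) s≡1 | ∧-zeroʳ (adj (K m) i j) = case h of λ ()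

≢⇒adj-K⁻ : ∀ {m} {i j : Fin m} → i ≢ j → toℕ i + toℕ j ≢ 1 → adj (K⁻ m) i j ≡ true
≢⇒adj-K⁻ {i = i} {j} i≢j s≢1
  rewrite ≢⇒adj-K i≢j | dec-false (toℕ i + toℕ j ℕ.≟ 1) s≢1 = refl

EdgeIn-sym : ∀ {n m} {G : Graph n} {H : Graph m} (c : Copy G H) {x y} → EdgeIn c x y → EdgeIn c y x
EdgeIn-sym {H = H} c (i , j , h , p , q) = j , i , trans (adj-sym H j i) h , q , p

SamePair⇒EdgeIn : ∀ {n m} {G : Graph n} {H : Graph m} (c : Copy G H) {x y a b} →
                  SamePair x y a b → EdgeIn c a b → EdgeIn c x y
SamePair⇒EdgeIn c (inj₁ (refl , refl)) e = e
SamePair⇒EdgeIn c (inj₂ (refl , refl)) e = EdgeIn-sym c e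

module _ {n} (G : Graph n) {M : Fin n → Set}
         (clique : ∀ x y → M x → M y → x ≢ y → adj G x y ≡ true) where

  cliqueCopy : ∀ {t} → Enumeration M t → Copy G (K t)
  cliqueCopy {t} E = record
    { φ     = element E
    ; φ-inj = injective E
    ; φ-hom = λ i j h → clique _ _ (sound E i) (sound E j) (adj⇒≢ (K t) h ∘ injective E)
    }

  cliqueCopy-edge⇒ : ∀ {t} (E : Enumeration M t) {x y} → EdgeIn (cliqueCopy E) x y → M x × M y
  cliqueCopy-edge⇒ E (i , j , _ , refl , refl) = sound E i , sound E j

  cliqueCopy-edge⇐ : ∀ {t} (E : Enumeration M t) {x y} → M x → M y → x ≢ y → EdgeIn (cliqueCopy E) x y
  cliqueCopy-edge⇐ E {x} {y} mx my x≢y with complete E x mx | complete E y my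
  ... | i , refl | j , refl = i , j , ≢⇒adj-K (x≢y ∘ cong (element E)) , refl , refl

  module _ {t a c} (E : Enumeration M t) (starts : StartsWith E a c) where

    cliqueMinusCopy : Copy G (K⁻ t)
    cliqueMinusCopy = record
      { φ     = element E
      ; φ-inj = injective E
      ; φ-hom = λ i j h → clique _ _ (sound E i) (sound E j) (adj⇒≢ (K⁻ t) h ∘ injective E)
      }

    cliqueMinusCopy-edge⇒ : ∀ {x y} → EdgeIn cliqueMinusCopy x y → M x × M y × ¬ SamePair x y a c
    cliqueMinusCopy-edge⇒ (i , j , h , refl , refl) =
      sound E i , sound E j , adj-K⁻⇒ {i = i} {j} h ∘ Equivalence.from (starts {i} {j})

    cliqueMinusCopy-edge⇐ : ∀ {x y} → M x → M y → x ≢ y → ¬ SamePair x y a c →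
                            EdgeIn cliqueMinusCopy x y
    cliqueMinusCopy-edge⇐ {x} {y} mx my x≢y ¬xy≐ac with complete E x mx | complete E y my
    ... | i , refl | j , refl =
      i , j , ≢⇒adj-K⁻ (x≢y ∘ cong (element E)) (¬xy≐ac ∘ Equivalence.to (starts {i} {j})) , refl , refl

fkDecomposition-↔ : ∀ {k n N} {G : Graph n} {I : Set} → Fin N ↔ I →
  (shape : I → Shape) (piece : ∀ z → Copy G (shapeGraph k (shape z))) →
  (∀ u v → adj G u v ≡ true → ∃[ z ] EdgeIn (piece z) u v) →
  (∀ u v → adj G u v ≡ true → ∀ z z′ → EdgeIn (piece z) u v → EdgeIn (piece z′) u v → z ≡ z′) →
  FkDecomposition k G
fkDecomposition-↔ {N = N} ι shape piece cover unique = record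
  { N      = N
  ; shape  = shape ∘ to
  ; piece  = piece ∘ to
  ; cover  = λ u v h → let z , e = cover u v h
                       in from z , subst (λ z → EdgeIn (piece z) u v) (sym (strictlyInverseˡ z)) e
  ; unique = λ u v h c c′ e e′ → Injection.injective (↔⇒↣ ι) (unique u v h _ _ e e′)
  }
  where open Inverse ι

module Construction {n : ℕ} (k : ℕ) (D : PairDesign n (tOf k)) (G : Graph n) (π : Permutation′ n)
                    (good : GoodPerm D G π k) where

  open GoodPerm good
  open RSubset using (sel; sel-inj; sel-Kt)

  _∈ₛ_ : Fin n → Fin (b D) → Set
  x ∈ₛ B = _∈π_ D G π x B

  _∈ₛ?_ : ∀ x B → Dec (x ∈ₛ B)
  x ∈ₛ? B = (π ⟨$⟩ˡ x) ∈? blk D B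

  ⟨$⟩ˡ-injective : ∀ {x y} → π ⟨$⟩ˡ x ≡ π ⟨$⟩ˡ y → x ≡ y
  ⟨$⟩ˡ-injective = Injection.injective (↔⇒↣ (flip π))

  blockOf : ∀ {x y} → x ≢ y → ∃[ B ] (x ∈ₛ B × y ∈ₛ B)
  blockOf {x} {y} x≢y = pair-cover D (π ⟨$⟩ˡ x) (π ⟨$⟩ˡ y) (x≢y ∘ ⟨$⟩ˡ-injective)

  block-unique : ∀ {x y B B′} → x ≢ y → x ∈ₛ B → y ∈ₛ B → x ∈ₛ B′ → y ∈ₛ B′ → B ≡ B′
  block-unique {x} {y} {B} {B′} x≢y = pair-unique D (π ⟨$⟩ˡ x) (π ⟨$⟩ˡ y) (x≢y ∘ ⟨$⟩ˡ-injective) B B′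

  blockEnumeration : ∀ B → Enumeration (_∈ₛ B) (tOf k)
  blockEnumeration B = subst (Enumeration (_∈ₛ B)) (blk-size D B) (map-↔ π (subsetEnumeration (blk D B)))

  IsKt? : ∀ B → Dec (IsKt D G π B)
  IsKt? B = all? λ x → all? λ y →
    (x ∈ₛ? B) →-dec ((y ∈ₛ? B) →-dec (¬? (x ≟ y) →-dec (adj G x y ≟ᵇ true)))

  InA? : ∀ u v → Dec (InA D G π u v)
  InA? u v = (adj G u v ≟ᵇ true) ×-dec any? (λ B → (u ∈ₛ? B) ×-dec ((v ∈ₛ? B) ×-dec ¬? (IsKt? B)))

  OrientedA : Fin n × Fin n → Set
  OrientedA (u , v) = u Fin.< v × InA D G π u v

  opaque
    A-edges : ∃[ N ] Enumeration OrientedA N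
    A-edges = decidableEnumeration-↔ *↔× λ (u , v) → (u <? v) ×-dec InA? u v

    Kt-blocks : ∃[ N ] Enumeration (IsKt D G π) N
    Kt-blocks = decidableEnumeration IsKt?

  NA NB : ℕ
  NA = proj₁ A-edges
  NB = proj₁ Kt-blocks

  u v : Fin NA → Fin n
  u e = proj₁ (element (proj₂ A-edges) e)
  v e = proj₂ (element (proj₂ A-edges) e)

  u<v : ∀ e → u e Fin.< v e
  u<v e = proj₁ (sound (proj₂ A-edges) e)

  inA : ∀ e → InA D G π (u e) (v e)
  inA e = proj₂ (sound (proj₂ A-edges) e)

  chosen : Fin NA → RSubset D G π (rOf k)
  chosen e = S (u e) (v e) (u<v e) (inA e)

  selected : Fin NA → Fin (rOf k) → Fin (b D)
  selected e = sel (chosen e)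

  chosen-good : ∀ e → GoodFor D G π k (chosen e) (u e) (v e)
  chosen-good e = S-good (u e) (v e) (u<v e) (inA e)

  f₁ f₂ : Fin NA → Fin (rOf k) → Fin n
  f₁ e l = proj₁ (proj₁ (chosen-good e) l)
  f₂ e l = proj₂ (proj₁ (chosen-good e) l)

  f-in-block : ∀ e l → EdgeOfBlock D G π (selected e l) (f₁ e l) (f₂ e l)
  f-in-block e l = proj₁ (proj₂ (chosen-good e)) l

  κ : Fin NA → Copy G (K k)
  κ e = proj₁ (proj₂ (proj₂ (chosen-good e)))

  κ-uv : ∀ e → EdgeIn (κ e) (u e) (v e)
  κ-uv e = proj₁ (proj₂ (proj₂ (proj₂ (chosen-good e))))

  κ-f : ∀ e l → EdgeIn (κ e) (f₁ e l) (f₂ e l)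
  κ-f e l = proj₁ (proj₂ (proj₂ (proj₂ (proj₂ (chosen-good e))))) l

  OnK : Fin NA → Fin n → Fin n → Set
  OnK e x y = SamePair x y (u e) (v e) ⊎ ∃[ l ] SamePair x y (f₁ e l) (f₂ e l)

  κ-edge⇒ : ∀ e {x y} → EdgeIn (κ e) x y → OnK e x y
  κ-edge⇒ e (i , j , h , refl , refl) = proj₂ (proj₂ (proj₂ (proj₂ (proj₂ (chosen-good e))))) i j h

  endpoints-determine : ∀ {e e′} → u e ≡ u e′ → v e ≡ v e′ → e ≡ e′
  endpoints-determine p q = injective (proj₂ A-edges) (cong₂ _,_ p q)

  selection-injective : ∀ {e e′ l l′} → selected e l ≡ selected e′ l′ → e ≡ e′ × l ≡ l′
  selection-injective {e} {e′} {l} {l′} eq with e ≟ e′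
  ... | yes refl = refl , sel-inj (chosen e) {l} {l′} eq
  ... | no e≢e′  = ⊥-elim (S-disj (u e) (v e) (u e′) (v e′) (u<v e) (u<v e′) (inA e) (inA e′)
                             (λ (p , q) → e≢e′ (endpoints-determine p q)) l l′ eq)

  A-edge-unique : ∀ {e e′ x y} → SamePair x y (u e) (v e) → SamePair x y (u e′) (v e′) → e ≡ e′
  A-edge-unique (inj₁ (refl , refl)) (inj₁ (p , q)) = endpoints-determine p q
  A-edge-unique (inj₂ (refl , refl)) (inj₂ (p , q)) = endpoints-determine q p
  A-edge-unique {e} {e′} (inj₁ (refl , refl)) (inj₂ (p , q)) =
    ⊥-elim (<-asym (u<v e′) (subst₂ Fin._<_ p q (u<v e)))
  A-edge-unique {e} {e′} (inj₂ (refl , refl)) (inj₁ (p , q)) =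
    ⊥-elim (<-asym (u<v e′) (subst₂ Fin._<_ q p (u<v e)))

  A-edge-not-in-Kt-block : ∀ {e x y B} → x ≢ y → SamePair x y (u e) (v e) →
                           x ∈ₛ B → y ∈ₛ B → ¬ IsKt D G π B
  A-edge-not-in-Kt-block {e} x≢y s xB yB =
    let B₀ , uB₀ , vB₀ , ¬Kt = proj₂ (inA e)
        xB₀ , yB₀ = SamePair-subst s uB₀ vB₀
    in  ¬Kt ∘ subst (IsKt D G π) (block-unique x≢y xB yB xB₀ yB₀)

  f-endpoints : ∀ {e l x y} → SamePair x y (f₁ e l) (f₂ e l) → x ∈ₛ selected e l × y ∈ₛ selected e l
  f-endpoints {e} {l} s = SamePair-subst s (proj₁ (f-in-block e l)) (proj₁ (proj₂ (f-in-block e l)))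

  f-block : ∀ {e l x y B} → x ≢ y → SamePair x y (f₁ e l) (f₂ e l) → x ∈ₛ B → y ∈ₛ B → selected e l ≡ B
  f-block x≢y s = block-unique x≢y (proj₁ (f-endpoints s)) (proj₂ (f-endpoints s))

  κ-unique : ∀ {e e′ x y} → x ≢ y → OnK e x y → OnK e′ x y → e ≡ e′
  κ-unique x≢y (inj₁ s) (inj₁ s′) = A-edge-unique s s′
  κ-unique {e′ = e′} x≢y (inj₁ s) (inj₂ (l′ , s′)) =
    let xS , yS = f-endpoints s′ in ⊥-elim (A-edge-not-in-Kt-block x≢y s xS yS (sel-Kt (chosen e′) l′))
  κ-unique {e} x≢y (inj₂ (l , s)) (inj₁ s′) =
    let xS , yS = f-endpoints s in ⊥-elim (A-edge-not-in-Kt-block x≢y s′ xS yS (sel-Kt (chosen e) l))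
  κ-unique x≢y (inj₂ (l , s)) (inj₂ (l′ , s′)) =
    let xS , yS = f-endpoints s′ in proj₁ (selection-injective (f-block x≢y s xS yS))

  Kt-block : Fin NB → Fin (b D)
  Kt-block = element (proj₂ Kt-blocks)

  Kt-clique : ∀ d → IsKt D G π (Kt-block d)
  Kt-clique = sound (proj₂ Kt-blocks)

  Used : Fin (b D) → Set
  Used B = ∃[ e ] ∃[ l ] selected e l ≡ B

  Used? : ∀ B → Dec (Used B)
  Used? B = any? λ e → any? λ l → selected e l ≟ B

  pinnedEnumeration : ∀ {e l B} → selected e l ≡ B →
                      Σ[ E ∈ Enumeration (_∈ₛ B) (tOf k) ] StartsWith E (f₁ e l) (f₂ e l)
  pinnedEnumeration {e} {l} refl =
    let f₁∈ , f₂∈ , h = f-in-block e l in enumerationStartingWith (blockEnumeration _) f₁∈ f₂∈ (adj⇒≢ G h)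

  Piece : Set
  Piece = Σ Shape λ s → Copy G (shapeGraph k s)

  blockPiece : ∀ d → Dec (Used (Kt-block d)) → Piece
  blockPiece d (no _)              = shT , cliqueCopy G (Kt-clique d) (blockEnumeration (Kt-block d))
  blockPiece d (yes (e , l , eq)) = shT⁻ , cliqueMinusCopy G (Kt-clique d) (proj₁ P) (proj₂ P)
    where P = pinnedEnumeration eq

  Retained : ∀ {B} → Dec (Used B) → Fin n → Fin n → Set
  Retained (yes (e , l , _)) x y = ¬ SamePair x y (f₁ e l) (f₂ e l)
  Retained (no _)            _ _ = ⊤

  blockPiece-edge⇒ : ∀ d (used : Dec (Used (Kt-block d))) {x y} → EdgeIn (proj₂ (blockPiece d used)) x y →
                     x ∈ₛ Kt-block d × y ∈ₛ Kt-block d × Retained used x y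
  blockPiece-edge⇒ d (no _) c =
    let xB , yB = cliqueCopy-edge⇒ G (Kt-clique d) (blockEnumeration (Kt-block d)) c in xB , yB , tt
  blockPiece-edge⇒ d (yes (e , l , eq)) =
    cliqueMinusCopy-edge⇒ G (Kt-clique d) (proj₁ (pinnedEnumeration eq)) (proj₂ (pinnedEnumeration eq))

  OnBlock : Fin NB → Fin n → Fin n → Set
  OnBlock d x y = x ∈ₛ Kt-block d × y ∈ₛ Kt-block d × Retained (Used? (Kt-block d)) x y

  κ-block-disjoint : ∀ {e d x y} → x ≢ y → OnK e x y → OnBlock d x y → ⊥
  κ-block-disjoint {d = d} x≢y (inj₁ s) (xB , yB , _) = A-edge-not-in-Kt-block x≢y s xB yB (Kt-clique d)
  κ-block-disjoint {e} {d} {x} {y} x≢y (inj₂ (l , s)) (xB , yB , kept) = omitted (Used? (Kt-block d)) kept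
    where
    selected-here : selected e l ≡ Kt-block d
    selected-here = f-block x≢y s xB yB

    omitted : (used : Dec (Used (Kt-block d))) → ¬ Retained used x y
    omitted (no unused) _ = unused (e , l , selected-here)
    omitted (yes (e′ , l′ , selected-there)) kept′
      with selection-injective (trans selected-here (sym selected-there))
    ... | refl , refl = kept′ s

  piece : Fin NA ⊎ Fin NB → Piece
  piece (inj₁ e) = shK , κ e
  piece (inj₂ d) = blockPiece d (Used? (Kt-block d))

  OnPiece : Fin NA ⊎ Fin NB → Fin n → Fin n → Set
  OnPiece (inj₁ e) = OnK e
  OnPiece (inj₂ d) = OnBlock d

  piece-edge⇒ : ∀ z {x y} → EdgeIn (proj₂ (piece z)) x y → OnPiece z x y
  piece-edge⇒ (inj₁ e) = κ-edge⇒ e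
  piece-edge⇒ (inj₂ d) = blockPiece-edge⇒ d (Used? (Kt-block d))

  piece-unique : ∀ z z′ {x y} → x ≢ y → OnPiece z x y → OnPiece z′ x y → z ≡ z′
  piece-unique (inj₁ e) (inj₁ e′) x≢y p p′ = cong inj₁ (κ-unique x≢y p p′)
  piece-unique (inj₁ e) (inj₂ d)  x≢y p p′ = ⊥-elim (κ-block-disjoint x≢y p p′)
  piece-unique (inj₂ d) (inj₁ e)  x≢y p p′ = ⊥-elim (κ-block-disjoint x≢y p′ p)
  piece-unique (inj₂ d) (inj₂ d′) x≢y (xB , yB , _) (xB′ , yB′ , _) =
    cong inj₂ (injective (proj₂ Kt-blocks) (block-unique x≢y xB yB xB′ yB′))

  κ-covers-own-edge : ∀ {e x y} → element (proj₂ A-edges) e ≡ (x , y) → EdgeIn (κ e) x y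
  κ-covers-own-edge {e} eq = subst₂ (EdgeIn (κ e)) (cong proj₁ eq) (cong proj₂ eq) (κ-uv e)

  A-edge-covered : ∀ {x y B} → adj G x y ≡ true → x ∈ₛ B → y ∈ₛ B → ¬ IsKt D G π B →
                   ∃[ e ] EdgeIn (κ e) x y
  A-edge-covered {x} {y} h xB yB ¬Kt with <-cmp x y
  ... | tri< x<y _ _ = let e , eq = complete (proj₂ A-edges) (x , y) (x<y , h , _ , xB , yB , ¬Kt)
                       in  e , κ-covers-own-edge eq
  ... | tri≈ _ x≡y _ = ⊥-elim (adj⇒≢ G h x≡y)
  ... | tri> _ _ y<x = let e , eq = complete (proj₂ A-edges) (y , x)
                                      (y<x , trans (adj-sym G y x) h , _ , yB , xB , ¬Kt)
                       in  e , EdgeIn-sym (κ e) (κ-covers-own-edge eq)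

  Kt-block-covered : ∀ d (used : Dec (Used (Kt-block d))) {x y} → x ∈ₛ Kt-block d → y ∈ₛ Kt-block d → x ≢ y →
                     EdgeIn (proj₂ (blockPiece d used)) x y ⊎ ∃[ e ] EdgeIn (κ e) x y
  Kt-block-covered d (no _) xB yB x≢y =
    inj₁ (cliqueCopy-edge⇐ G (Kt-clique d) (blockEnumeration (Kt-block d)) xB yB x≢y)
  Kt-block-covered d (yes (e , l , eq)) {x} {y} xB yB x≢y with SamePair? x y (f₁ e l) (f₂ e l)
  ... | yes s  = inj₂ (e , SamePair⇒EdgeIn (κ e) s (κ-f e l))
  ... | no ¬s = inj₁ (cliqueMinusCopy-edge⇐ G (Kt-clique d) (proj₁ (pinnedEnumeration eq))
                        (proj₂ (pinnedEnumeration eq)) xB yB x≢y ¬s)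

  covered : ∀ x y → adj G x y ≡ true → ∃[ z ] EdgeIn (proj₂ (piece z)) x y
  covered x y h with blockOf (adj⇒≢ G h)
  ... | B , xB , yB with IsKt? B
  ...   | no ¬Kt = let e , c = A-edge-covered h xB yB ¬Kt in inj₁ e , c
  ...   | yes Kt with complete (proj₂ Kt-blocks) B Kt
  ...     | d , refl with Kt-block-covered d (Used? (Kt-block d)) xB yB (adj⇒≢ G h)
  ...       | inj₁ c       = inj₂ d , c
  ...       | inj₂ (e , c) = inj₁ e , c

  decomposition : FkDecomposition k G
  decomposition = fkDecomposition-↔ +↔⊎ (proj₁ ∘ piece) (proj₂ ∘ piece) covered
    λ x y h z z′ c c′ → piece-unique z z′ (adj⇒≢ G h) (piece-edge⇒ z c) (piece-edge⇒ z′ c′)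

lemma2p5 : (k : ℕ) → 3 ≤ k →
           (n : ℕ) → (∃[ q ] n ≡ 1 + q * (tOf k * (tOf k ∸ 1))) →
           (D : PairDesign n (tOf k)) → (G : Graph n) → (π : Permutation′ n) →
           GoodPerm D G π k →
           FkDecomposition k G
lemma2p5 k _ n _ D G π good = Construction.decomposition k D G π good
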